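{- If a linear CNF formula $\phi$ has a $(k+1)$-winning strategy, then $\phi$ has no $\mathrm{Res}(\oplus)$ refutation of width at most $k$.
   Context: A linear clause is a disjunction of linear literals $f=\alpha$ ($f$ a linear form over $\mathbb{F}_2$, $\alpha\in\{0,1\}$); its width is its number of linear literals. $\mathrm{Res}(\oplus)$ rules: from $A\lor(f=0)$ and $B\lor(f=1)$ derive $A\lor B$; from $C$ derive any linear clause semantically implied by $C$. A refutation is a derivation of the empty clause from the clauses of $\phi$; its width is the maximum width of its clauses. For linear systems, $|\mathcal{F}|$ is the number of equations and $\mathcal{F}\vDash\mathcal{G}$ means every solution of $\mathcal{F}$ solves $\mathcal{G}$. A non-empty family $\mathcal{H}$ of linear systems over $\mathbb{F}_2$ in the variables of $\phi$ is a $k$-winning strategy if: (1) every $\mathcal{F}\in\mathcal{H}$ has $|\mathcal{F}|\le k$; (2) for every $\mathcal{F}\in\mathcal{H}$ and every clause $C$ of $\phi$ some solution of $\mathcal{F}$ satisfies $C$; (3) if $|\mathcal{G}|\le k$ and $\mathcal{F}\vDash\mathcal{G}$ for some $\mathcal{F}\in\mathcal{H}$, then $\mathcal{G}\in\mathcal{H}$; (4) for every $\mathcal{F}\in\mathcal{H}$ with $|\mathcal{F}|<k$ and every linear form $f$ there is $a\in\mathbb{F}_2$ with $\mathcal{F}\land(f=a)\in\mathcal{H}$. -}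

module Defs where

open import Data.Nat using (ℕ; suc; _≤_; _<_)
open import Data.Bool using (Bool; true; false; _xor_; _∧_)
open import Data.Fin using (Fin) renaming (zero to fzero; suc to fsuc)
open import Data.Vec using (Vec; []; _∷_; lookup)
open import Data.List using (List; []; _∷_; _++_; length)
open import Data.List.Relation.Unary.Any using (Any)
open import Data.List.Relation.Unary.All using (All)
open import Data.List.Membership.Propositional using (_∈_)
open import Data.Product using (Σ; _×_; _,_; ∃)
open import Relation.Binary.PropositionalEquality using (_≡_)

-- A linear form over 𝔽₂ in n variables x₁..xₙ (no constant term):
-- the coefficient vector (a₁,…,aₙ) ∈ 𝔽₂ⁿ, representing Σ aᵢ xᵢ.
LinForm : ℕ → Set
LinForm n = Vec Bool n

Assignment : ℕ → Set
Assignment n = Fin n → Bool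

evalForm : ∀ {n} → LinForm n → Assignment n → Bool
evalForm [] x = false
evalForm (a ∷ f) x = (a ∧ x fzero) xor evalForm f (λ i → x (fsuc i))

record LinLit (n : ℕ) : Set where
  constructor _≐_
  field
    form : LinForm n
    rhs  : Bool
open LinLit public

SatLit : ∀ {n} → Assignment n → LinLit n → Set
SatLit x (f ≐ α) = evalForm f x ≡ α

LinClause : ℕ → Set
LinClause n = List (LinLit n)

width : ∀ {n} → LinClause n → ℕ
width = length

SatClause : ∀ {n} → Assignment n → LinClause n → Set
SatClause x C = Any (SatLit x) C

LinCNF : ℕ → Set
LinCNF n = List (LinClause n)

-- Clauses are disjunctions, i.e. sets of literals: equality of clauses
-- is equality of their underlying sets of literals.
_⊆ₗ_ : ∀ {n} → LinClause n → LinClause n → Set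
C ⊆ₗ D = ∀ {l} → l ∈ C → l ∈ D

_≈ₗ_ : ∀ {n} → LinClause n → LinClause n → Set
C ≈ₗ D = (C ⊆ₗ D) × (D ⊆ₗ C)

_⊨ᶜ_ : ∀ {n} → LinClause n → LinClause n → Set
C ⊨ᶜ D = ∀ x → SatClause x C → SatClause x D

data ResDeriv {n : ℕ} (φ : LinCNF n) (k : ℕ) : LinClause n → Set where
  axiom : ∀ {C D} → C ∈ φ → D ≈ₗ C → width D ≤ k → ResDeriv φ k D
  resolve : ∀ {C₁ C₂ D} (A B : LinClause n) (f : LinForm n) →
            ResDeriv φ k C₁ → ResDeriv φ k C₂ →
            C₁ ≈ₗ ((f ≐ false) ∷ A) → C₂ ≈ₗ ((f ≐ true) ∷ B) →
            D ≈ₗ (A ++ B) → width D ≤ k → ResDeriv φ k D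
  weaken : ∀ {C D} → ResDeriv φ k C → C ⊨ᶜ D → width D ≤ k → ResDeriv φ k D

HasRefutationOfWidth≤ : ∀ {n} → LinCNF n → ℕ → Set
HasRefutationOfWidth≤ φ k = ResDeriv φ k []

LinSys : ℕ → Set
LinSys n = List (LinLit n)

size : ∀ {n} → LinSys n → ℕ
size = length

Solves : ∀ {n} → Assignment n → LinSys n → Set
Solves x F = All (SatLit x) F

_⊨ˢ_ : ∀ {n} → LinSys n → LinSys n → Set
F ⊨ˢ G = ∀ x → Solves x F → Solves x G

_∧≐_ : ∀ {n} → LinSys n → LinLit n → LinSys n
F ∧≐ l = l ∷ F

record WinningStrategy {n : ℕ} (φ : LinCNF n) (k : ℕ) (H : LinSys n → Set) : Set where
  field
    nonEmpty  : ∃ λ F → H F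
    bounded   : ∀ F → H F → size F ≤ k
    satisfies : ∀ F → H F → ∀ C → C ∈ φ → ∃ λ x → Solves x F × SatClause x C
    closed    : ∀ F G → H F → size G ≤ k → F ⊨ˢ G → H G
    extend    : ∀ F → H F → size F < k → ∀ (f : LinForm n) →
                ∃ λ (a : Bool) → H (F ∧≐ (f ≐ a))

HasWinningStrategy : ∀ {n} → LinCNF n → ℕ → Set₁
HasWinningStrategy {n} φ k = Σ (LinSys n → Set) λ H → WinningStrategy φ k H

-- The negation ¬D of a clause D, the system of the negated literals, has width D
-- equations and its solutions are exactly the assignments falsifying D.
-- Along a width-k derivation, ¬D stays outside a (k+1)-winning strategy H:
-- for an axiom by condition (2); for a weakening of C to D because ¬D ⊨ ¬C and
-- (3); for a resolvent D of A ∨ (f = 0) and B ∨ (f = 1) because |¬D| ≤ k, so by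
-- (4) H contains ¬D ∧ (f = a) = ¬((f = ¬a) ∨ D), which by (3) puts the negation
-- of a premise in H. Finally the negation of the empty clause is the empty
-- system, which lies in H by (3).
module Submission where

open import Defs
open import Data.Nat using (ℕ; suc; _≤_; _<_; s≤s; z≤n)
open import Data.Nat.Properties using (m≤n⇒m≤1+n)
open import Data.Bool using (true; false; not)
open import Data.Bool.Properties using (not-¬; ¬-not)
open import Data.Product using (_,_; proj₂)
open import Data.List using ([]; map)
open import Data.List.Properties using (length-map)
open import Data.List.Relation.Unary.All using ([])
import Data.List.Relation.Unary.All as All
open import Data.List.Relation.Unary.All.Properties using (map⁺; map⁻; All¬⇒¬Any; ¬Any⇒All¬)
open import Data.List.Relation.Binary.Subset.Propositional.Properties
  using (Any-resp-⊆; ⊆-trans; ∷⁺ʳ; xs⊆xs++ys; xs⊆ys++xs)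
open import Relation.Nullary using (¬_)
open import Function using (_∘_)
open import Relation.Binary.PropositionalEquality using (_≡_; subst; sym)

module _ {n : ℕ} where

  negate : LinLit n → LinLit n
  negate (f ≐ a) = f ≐ not a

  negation : LinClause n → LinSys n
  negation = map negate

  size-negation : (C : LinClause n) → size (negation C) ≡ width C
  size-negation = length-map negate

  sat-negate⇒¬sat : ∀ {x l} → SatLit x (negate l) → ¬ SatLit x l
  sat-negate⇒¬sat {l = f ≐ a} f≡¬a f≡a = not-¬ f≡a f≡¬a

  ¬sat⇒sat-negate : ∀ {x l} → ¬ SatLit x l → SatLit x (negate l)
  ¬sat⇒sat-negate {l = f ≐ a} = ¬-not

  solves-negation⇒¬sat : ∀ {x} {C} → Solves x (negation C) → ¬ SatClause x C
  solves-negation⇒¬sat {x} s = All¬⇒¬Any (All.map (λ {l} → sat-negate⇒¬sat {x} {l}) (map⁻ s))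

  ¬sat⇒solves-negation : ∀ {x} {C} → ¬ SatClause x C → Solves x (negation C)
  ¬sat⇒solves-negation {x} {C} ¬s = map⁺ (All.map (λ {l} → ¬sat⇒sat-negate {x} {l}) (¬Any⇒All¬ C ¬s))

  negation-antitone : ∀ {C D} → C ⊨ᶜ D → negation D ⊨ˢ negation C
  negation-antitone C⊨D x s = ¬sat⇒solves-negation (solves-negation⇒¬sat s ∘ C⊨D x)

  ⊆ₗ⇒⊨ᶜ : ∀ {C D : LinClause n} → C ⊆ₗ D → C ⊨ᶜ D
  ⊆ₗ⇒⊨ᶜ C⊆D x = Any-resp-⊆ C⊆D

  derived-width≤ : ∀ {φ : LinCNF n} {k D} → ResDeriv φ k D → width D ≤ k
  derived-width≤ (axiom _ _ w) = w
  derived-width≤ (resolve _ _ _ _ _ _ _ _ w) = w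
  derived-width≤ (weaken _ _ w) = w

module _ {n : ℕ} {φ : LinCNF n} {k : ℕ} {H : LinSys n → Set}
         (strategy : WinningStrategy φ (suc k) H) where
  open WinningStrategy strategy

  negation∈-antitone : ∀ {C D} → H (negation D) → width C ≤ k → C ⊨ᶜ D → H (negation C)
  negation∈-antitone {C} {D} hD w C⊨D =
    closed (negation D) (negation C) hD
      (subst (_≤ suc k) (sym (size-negation C)) (m≤n⇒m≤1+n w))
      (negation-antitone C⊨D)

  derived⇒negation∉ : ∀ {D} → ResDeriv φ k D → ¬ H (negation D)
  derived⇒negation∉ {D} (axiom {C} C∈φ (_ , C⊆D) _) hD
    with satisfies (negation D) hD C C∈φ
  ... | x , s , sat = solves-negation⇒¬sat s (⊆ₗ⇒⊨ᶜ C⊆D x sat)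
  derived⇒negation∉ (weaken d C⊨D _) hD =
    derived⇒negation∉ d (negation∈-antitone hD (derived-width≤ d) C⊨D)
  derived⇒negation∉ {D} (resolve A B f d₁ d₂ (C₁⊆ , _) (C₂⊆ , _) (_ , A++B⊆D) w) hD
    with extend (negation D) hD (subst (_< suc k) (sym (size-negation D)) (s≤s w)) f
  ... | true , h = derived⇒negation∉ d₁
    (negation∈-antitone h (derived-width≤ d₁)
      (⊆ₗ⇒⊨ᶜ (⊆-trans C₁⊆ (∷⁺ʳ _ (⊆-trans (xs⊆xs++ys A B) A++B⊆D)))))
  ... | false , h = derived⇒negation∉ d₂
    (negation∈-antitone h (derived-width≤ d₂)
      (⊆ₗ⇒⊨ᶜ (⊆-trans C₂⊆ (∷⁺ʳ _ (⊆-trans (xs⊆ys++xs B A) A++B⊆D)))))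

  []∈strategy : H []
  []∈strategy = closed _ [] (proj₂ nonEmpty) z≤n (λ _ _ → [])

lemma4p2 : ∀ {n : ℕ} (φ : LinCNF n) (k : ℕ) →
    HasWinningStrategy φ (suc k) → ¬ HasRefutationOfWidth≤ φ k
lemma4p2 φ k (H , strategy) refutation =
  derived⇒negation∉ strategy refutation ([]∈strategy strategy)
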